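{- Let $n\in\mathbb{N}$ and $M,N\in\mathcal{M}(n)$. If $N$ is obtained from $M$ by the n-c transformation, then the set of smaller elements of edges of $N$ equals that of $M$, the set of larger elements of edges of $N$ equals that of $M$, and $ne(N)=ne(M)-1$, $cr(N)=cr(M)+1$. If $N$ is obtained from $M$ by the c-n transformation, then the same two sets coincide for $M$ and $N$ and $ne(N)=ne(M)+1$, $cr(N)=cr(M)-1$.
   Context: A matching on $[2n]$ is a partition of $[2n]$ into $n$ two-element blocks (edges); $\mathcal{M}(n)$ is the set of such matchings. Edges cross if $\min A<\min B<\max A<\max B$ (or vice versa), are nested if $\min A<\min B<\max B<\max A$ (or vice versa); $cr,ne$ count crossing and nested pairs. The width of a nesting $\{a,d\},\{b,c\}$ with $a<b<c<d$ is $\min(b-a,d-c)$; the width of a crossing $\{a,c\},\{b,d\}$ with $a<b<c<d$ is $\min(b-a,d-c)$. The n-c transformation (applicable when $M$ has a nesting): choose a nesting $\{a,d\},\{b,c\}$ ($a<b<c<d$) of minimum width among all nestings of $M$; if the width equals $b-a$ swap the smaller elements of the two edges, otherwise swap their larger elements (in either case the two edges are replaced by $\{a,c\},\{b,d\}$). The c-n transformation (applicable when $M$ has a crossing): choose a crossing $\{a,c\},\{b,d\}$ ($a<b<c<d$) of minimum width among all crossings; if the width equals $b-a$ swap the smaller elements, otherwise swap the larger elements (in either case the edges are replaced by $\{a,d\},\{b,c\}$). -}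

module Defs where

open import Data.Nat using (ℕ; _*_; _∸_; _⊓_; _≤_)
open import Data.Fin using (Fin; toℕ; _<_; _<?_)
open import Data.List using (List; length; filter; allFin; cartesianProduct)
open import Data.Product using (Σ; _×_; _,_; proj₁; proj₂)
open import Relation.Binary.PropositionalEquality using (_≡_; _≢_)
open import Relation.Nullary.Decidable using (Dec; _×-dec_)

-- A perfect matching on [2n] (elements represented by Fin (2 * n)),
-- given by its partner map: a fixed-point-free involution.
-- The edges are the blocks {i , partner i}.
record Matching (n : ℕ) : Set where
  field
    partner      : Fin (2 * n) → Fin (2 * n)
    involutive   : ∀ i → partner (partner i) ≡ i
    fixpointFree : ∀ i → partner i ≢ i
open Matching public

module _ {n : ℕ} (M : Matching n) where
  private
    p = partner M

  IsCrossing : Fin (2 * n) → Fin (2 * n) → Set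
  IsCrossing a b = a < b × b < p a × p a < p b

  IsNesting : Fin (2 * n) → Fin (2 * n) → Set
  IsNesting a b = a < b × b < p b × p b < p a

  isCrossing? : (ab : Fin (2 * n) × Fin (2 * n)) → Dec (IsCrossing (proj₁ ab) (proj₂ ab))
  isCrossing? (a , b) = (a <? b) ×-dec ((b <? p a) ×-dec (p a <? p b))

  isNesting? : (ab : Fin (2 * n) × Fin (2 * n)) → Dec (IsNesting (proj₁ ab) (proj₂ ab))
  isNesting? (a , b) = (a <? b) ×-dec ((b <? p b) ×-dec (p b <? p a))

  allPairs : List (Fin (2 * n) × Fin (2 * n))
  allPairs = cartesianProduct (allFin (2 * n)) (allFin (2 * n))

  -- each crossing / nesting pair of edges is counted exactly once
  -- (indexed by the smaller endpoint of each edge, ordered)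
  cr : ℕ
  cr = length (filter isCrossing? allPairs)

  ne : ℕ
  ne = length (filter isNesting? allPairs)

  -- width of the nesting {a,d},{b,c} (a<b<c<d, c = p b, d = p a): min(b-a, d-c)
  nestWidth : Fin (2 * n) → Fin (2 * n) → ℕ
  nestWidth a b = (toℕ b ∸ toℕ a) ⊓ (toℕ (p a) ∸ toℕ (p b))

  -- width of the crossing {a,c},{b,d} (a<b<c<d, c = p a, d = p b): min(b-a, d-c)
  crossWidth : Fin (2 * n) → Fin (2 * n) → ℕ
  crossWidth a b = (toℕ b ∸ toℕ a) ⊓ (toℕ (p b) ∸ toℕ (p a))

-- N arises from M by replacing the two edges of M covering {a,b,c,d}
-- by the edges {u₁,v₁} and {u₂,v₂} (where {u₁,v₁,u₂,v₂} = {a,b,c,d}),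
-- all other edges unchanged.
Rewire : {n : ℕ} → Matching n → Matching n →
         (a b c d u₁ v₁ u₂ v₂ : Fin (2 * n)) → Set
Rewire M N a b c d u₁ v₁ u₂ v₂ =
  partner N u₁ ≡ v₁ × partner N v₁ ≡ u₁ ×
  partner N u₂ ≡ v₂ × partner N v₂ ≡ u₂ ×
  (∀ x → x ≢ a → x ≢ b → x ≢ c → x ≢ d → partner N x ≡ partner M x)

-- n-c transformation: pick a nesting {a,d},{b,c} (a<b<c<d) of minimum width;
-- swapping either the smaller or the larger elements yields {a,c},{b,d}.
NCStep : {n : ℕ} → Matching n → Matching n → Set
NCStep {n} M N =
  Σ (Fin (2 * n)) λ a → Σ (Fin (2 * n)) λ b →
    IsNesting M a b ×
    (∀ a' b' → IsNesting M a' b' → nestWidth M a b ≤ nestWidth M a' b') ×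
    Rewire M N a b (partner M b) (partner M a) a (partner M b) b (partner M a)

-- c-n transformation: pick a crossing {a,c},{b,d} (a<b<c<d) of minimum width;
-- swapping either the smaller or the larger elements yields {a,d},{b,c}.
CNStep : {n : ℕ} → Matching n → Matching n → Set
CNStep {n} M N =
  Σ (Fin (2 * n)) λ a → Σ (Fin (2 * n)) λ b →
    IsCrossing M a b ×
    (∀ a' b' → IsCrossing M a' b' → crossWidth M a b ≤ crossWidth M a' b') ×
    Rewire M N a b (partner M a) (partner M b) a (partner M b) b (partner M a)

SameOpenersClosers : {n : ℕ} → Matching n → Matching n → Set
SameOpenersClosers {n} M N =
  (∀ (i : Fin (2 * n)) → (i < partner N i → i < partner M i) × (i < partner M i → i < partner N i)) ×
  (∀ (i : Fin (2 * n)) → (partner N i < i → partner M i < i) × (partner M i < i → partner N i < i))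

-- ne and cr are double sums, over ordered pairs of positions x, y, of an indicator of the
-- relative order of x, y and their partners. The transformation rewires only the edges at
-- a < b < c < d, so only the rows and columns of a and b change. The rewired edges themselves
-- form the nesting {a,d},{b,c} on one side and the crossing {a,c},{b,d} on the other, which
-- accounts for the ±1. Any other edge {x, q} meets the rewired pair in the same way before and
-- after: if neither endpoint lies strictly between a and b, the exchange can be read as
-- swapping a and b; if neither lies between c and d, as swapping c and d. An edge with one
-- endpoint in each gap is ruled out by minimality: together with the edge at b it would form
-- a nesting (resp. crossing) of smaller width.

module Submission where

open import Defs
open import Data.Nat using (ℕ; _+_)
open import Data.Product using (_×_)
open import Relation.Binary.PropositionalEquality using (_≡_)

open import Data.Bool using (true; false; if_then_else_; _∧_)
open import Data.Empty using (⊥-elim)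
open import Data.Fin using (Fin; zero; suc; _<_; _<?_; _≟_)
open import Data.Fin.Properties using (suc-injective; <-trans; <-asym; <-irrefl; <-cmp; <⇒≢)
open import Data.List using (List; []; _∷_; _++_; length; filter; map; tabulate; allFin; cartesianProduct)
open import Data.List.Properties using (map-++; map-∘)
open import Data.Nat using (suc; s≤s; _*_; _≤_)
import Data.Nat.ListAction as List
open import Data.Nat.ListAction.Properties using (sum-++)
open import Data.Nat.Properties
  using (+-assoc; +-comm; +-identityʳ; +-commutativeSemigroup; +-0-commutativeMonoid;
         <⇒≤; <⇒≱; ⊓-mono-<; ∸-monoʳ-<; ∸-monoˡ-<)
open import Algebra.Properties.CommutativeMonoid.Sum +-0-commutativeMonoid
  using (sum; sum-syntax; ∑-distrib-+; sum-cong-≗)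
open import Algebra.Properties.CommutativeSemigroup +-commutativeSemigroup
  using (xy∙z≈xz∙y; xy∙z≈y∙xz)
open import Data.Product using (_,_)
open import Data.Sum using (_⊎_; inj₁; inj₂)
import Data.Sum as Sum
open import Function using (_∘_; id)
open import Relation.Binary using (tri<; tri≈; tri>)
open import Relation.Binary.PropositionalEquality
  using (_≢_; refl; sym; trans; cong; cong₂; subst; ≢-sym; module ≡-Reasoning)
open import Relation.Nullary using (Dec; does; yes; no; ¬_)
open import Relation.Nullary.Decidable using (dec-true; dec-false; _×-dec_)
open import Relation.Unary using (Pred; Decidable)

open ≡-Reasoning

indicator : ∀ {p} {P : Set p} → Dec P → ℕ
indicator P? = if does P? then 1 else 0

length-filter≡sum-indicator : ∀ {a p} {A : Set a} {P : Pred A p} (P? : Decidable P) (xs : List A) →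
  length (filter P? xs) ≡ List.sum (map (λ x → indicator (P? x)) xs)
length-filter≡sum-indicator P? [] = refl
length-filter≡sum-indicator P? (x ∷ xs) with does (P? x)
... | true  = cong suc (length-filter≡sum-indicator P? xs)
... | false = length-filter≡sum-indicator P? xs

sum-map-cartesianProduct : ∀ {a b} {A : Set a} {B : Set b} (f : A × B → ℕ) (xs : List A) (ys : List B) →
  List.sum (map f (cartesianProduct xs ys)) ≡ List.sum (map (λ x → List.sum (map (λ y → f (x , y)) ys)) xs)
sum-map-cartesianProduct f [] ys = refl
sum-map-cartesianProduct f (x ∷ xs) ys = begin
  List.sum (map f (map (x ,_) ys ++ cartesianProduct xs ys))
    ≡⟨ cong List.sum (map-++ f (map (x ,_) ys) _) ⟩
  List.sum (map f (map (x ,_) ys) ++ map f (cartesianProduct xs ys))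
    ≡⟨ sum-++ (map f (map (x ,_) ys)) _ ⟩
  List.sum (map f (map (x ,_) ys)) + List.sum (map f (cartesianProduct xs ys))
    ≡⟨ cong₂ _+_ (cong List.sum (sym (map-∘ ys))) (sum-map-cartesianProduct f xs ys) ⟩
  List.sum (map (λ y → f (x , y)) ys) + List.sum (map (λ x → List.sum (map (λ y → f (x , y)) ys)) xs)
    ∎

sum-map-tabulate : ∀ {a} {A : Set a} {m} (f : A → ℕ) (g : Fin m → A) →
  List.sum (map f (tabulate g)) ≡ ∑[ i < m ] f (g i)
sum-map-tabulate {m = 0}     f g = refl
sum-map-tabulate {m = suc m} f g = cong (f (g zero) +_) (sum-map-tabulate f (g ∘ suc))

length-filter-allFin-pairs : ∀ {m p} {P : Pred (Fin m × Fin m) p} (P? : Decidable P) →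
  length (filter P? (cartesianProduct (allFin m) (allFin m))) ≡
  ∑[ x < m ] ∑[ y < m ] indicator (P? (x , y))
length-filter-allFin-pairs {m} P? = begin
  length (filter P? (cartesianProduct (allFin m) (allFin m)))
    ≡⟨ length-filter≡sum-indicator P? (cartesianProduct (allFin m) (allFin m)) ⟩
  List.sum (map (λ xy → indicator (P? xy)) (cartesianProduct (allFin m) (allFin m)))
    ≡⟨ sum-map-cartesianProduct _ (allFin m) (allFin m) ⟩
  List.sum (map (λ x → List.sum (map (λ y → indicator (P? (x , y))) (allFin m))) (allFin m))
    ≡⟨ sum-map-tabulate (λ x → List.sum (map (λ y → indicator (P? (x , y))) (allFin m))) id ⟩
  ∑[ x < m ] List.sum (map (λ y → indicator (P? (x , y))) (allFin m))
    ≡⟨ sum-cong-≗ (λ x → sum-map-tabulate (λ y → indicator (P? (x , y))) id) ⟩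
  ∑[ x < m ] ∑[ y < m ] indicator (P? (x , y))
    ∎

sum-cong-except₁ : ∀ {m} {j : Fin m} {f g : Fin m → ℕ} {l k : ℕ} →
  (∀ x → x ≢ j → f x ≡ g x) → f j + l ≡ g j + k → sum f + l ≡ sum g + k
sum-cong-except₁ {suc m} {zero} {f} {g} {l} {k} agree fj+l≡gj+k = begin
  f zero + sum (f ∘ suc) + l ≡⟨ xy∙z≈xz∙y (f zero) _ l ⟩
  f zero + l + sum (f ∘ suc) ≡⟨ cong₂ _+_ fj+l≡gj+k (sum-cong-≗ (λ x → agree (suc x) λ ())) ⟩
  g zero + k + sum (g ∘ suc) ≡⟨ xy∙z≈xz∙y (g zero) _ k ⟨
  g zero + sum (g ∘ suc) + k ∎
sum-cong-except₁ {suc m} {suc j} {f} {g} {l} {k} agree fj+l≡gj+k = begin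
  f zero + sum (f ∘ suc) + l   ≡⟨ +-assoc (f zero) _ l ⟩
  f zero + (sum (f ∘ suc) + l) ≡⟨ cong₂ _+_ (agree zero λ ()) (sum-cong-except₁ agree′ fj+l≡gj+k) ⟩
  g zero + (sum (g ∘ suc) + k) ≡⟨ +-assoc (g zero) _ k ⟨
  g zero + sum (g ∘ suc) + k   ∎
  where
  agree′ : ∀ x → x ≢ j → f (suc x) ≡ g (suc x)
  agree′ x x≢j = agree (suc x) (x≢j ∘ suc-injective)

sum-cong-except₂ : ∀ {m} {i j : Fin m} {f g : Fin m → ℕ} {l k : ℕ} → i < j →
  (∀ x → x ≢ i → x ≢ j → f x ≡ g x) → f i + f j + l ≡ g i + g j + k → sum f + l ≡ sum g + k
sum-cong-except₂ {suc m} {zero} {suc j} {f} {g} {l} {k} _ agree eq = begin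
  f zero + sum (f ∘ suc) + l   ≡⟨ xy∙z≈y∙xz (f zero) _ l ⟩
  sum (f ∘ suc) + (f zero + l) ≡⟨ sum-cong-except₁ agree′ eq′ ⟩
  sum (g ∘ suc) + (g zero + k) ≡⟨ xy∙z≈y∙xz (g zero) _ k ⟨
  g zero + sum (g ∘ suc) + k   ∎
  where
  agree′ : ∀ x → x ≢ j → f (suc x) ≡ g (suc x)
  agree′ x x≢j = agree (suc x) (λ ()) (x≢j ∘ suc-injective)
  eq′ : f (suc j) + (f zero + l) ≡ g (suc j) + (g zero + k)
  eq′ = trans (sym (xy∙z≈y∙xz (f zero) _ l)) (trans eq (xy∙z≈y∙xz (g zero) _ k))
sum-cong-except₂ {suc m} {suc i} {suc j} {f} {g} {l} {k} (s≤s i<j) agree eq = begin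
  f zero + sum (f ∘ suc) + l   ≡⟨ +-assoc (f zero) _ l ⟩
  f zero + (sum (f ∘ suc) + l) ≡⟨ cong₂ _+_ (agree zero (λ ()) (λ ())) (sum-cong-except₂ i<j agree′ eq) ⟩
  g zero + (sum (g ∘ suc) + k) ≡⟨ +-assoc (g zero) _ k ⟨
  g zero + sum (g ∘ suc) + k   ∎
  where
  agree′ : ∀ x → x ≢ i → x ≢ j → f (suc x) ≡ g (suc x)
  agree′ x x≢i x≢j = agree (suc x) (x≢i ∘ suc-injective) (x≢j ∘ suc-injective)

∑∑-cong-except₂ : ∀ {m} {a b : Fin m} {F G : Fin m → Fin m → ℕ} {l k : ℕ} → a < b →
  (∀ x y → x ≢ a → x ≢ b → y ≢ a → y ≢ b → F x y ≡ G x y) →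
  (∀ x → x ≢ a → x ≢ b → F x a + F x b ≡ G x a + G x b) →
  (∀ y → y ≢ a → y ≢ b → F a y + F b y ≡ G a y + G b y) →
  (F a a + F b a) + (F a b + F b b) + l ≡ (G a a + G b a) + (G a b + G b b) + k →
  ∑[ x < m ] ∑[ y < m ] F x y + l ≡ ∑[ x < m ] ∑[ y < m ] G x y + k
∑∑-cong-except₂ {m} {a} {b} {F} {G} {l} {k} a<b inner row column corner =
  sum-cong-except₂ a<b rows-agree rows-ab
  where
  rows-agree : ∀ x → x ≢ a → x ≢ b → sum (F x) ≡ sum (G x)
  rows-agree x x≢a x≢b = begin
    sum (F x)     ≡⟨ +-identityʳ _ ⟨
    sum (F x) + 0 ≡⟨ sum-cong-except₂ a<b (λ y → inner x y x≢a x≢b) (cong (_+ 0) (row x x≢a x≢b)) ⟩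
    sum (G x) + 0 ≡⟨ +-identityʳ _ ⟩
    sum (G x)     ∎
  rows-ab : sum (F a) + sum (F b) + l ≡ sum (G a) + sum (G b) + k
  rows-ab = begin
    sum (F a) + sum (F b) + l              ≡⟨ cong (_+ l) (∑-distrib-+ (F a) (F b)) ⟨
    ∑[ y < m ] (F a y + F b y) + l         ≡⟨ sum-cong-except₂ a<b column corner ⟩
    ∑[ y < m ] (G a y + G b y) + k         ≡⟨ cong (_+ k) (∑-distrib-+ (G a) (G b)) ⟩
    sum (G a) + sum (G b) + k              ∎

private variable
  m : ℕ
  t u v w₁ w₂ w₃ w₄ : Fin m

record SameSide (t u v : Fin m) : Set where
  constructor sameSide
  field
    seen-from-below : does (t <? u) ≡ does (t <? v)
    seen-from-above : does (u <? t) ≡ does (v <? t)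

sameSide-below : t < u → t < v → SameSide t u v
sameSide-below {t = t} {u} {v} t<u t<v = sameSide
  (trans (dec-true (t <? u) t<u) (sym (dec-true (t <? v) t<v)))
  (trans (dec-false (u <? t) (<-asym t<u)) (sym (dec-false (v <? t) (<-asym t<v))))

sameSide-above : u < t → v < t → SameSide t u v
sameSide-above {u = u} {t} {v} u<t v<t = sameSide
  (trans (dec-false (t <? u) (<-asym u<t)) (sym (dec-false (t <? v) (<-asym v<t))))
  (trans (dec-true (u <? t) u<t) (sym (dec-true (v <? t) v<t)))

sameSide-outside : u < v → t ≢ u → t ≢ v → ¬ (u < t × t < v) → SameSide t u v
sameSide-outside {u = u} {v} {t} u<v t≢u t≢v ¬between with <-cmp t u | <-cmp t v
... | tri< t<u _ _ | _            = sameSide-below t<u (<-trans t<u u<v)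
... | tri≈ _ t≡u _ | _            = ⊥-elim (t≢u t≡u)
... | tri> _ _ u<t | tri< t<v _ _ = ⊥-elim (¬between (u<t , t<v))
... | tri> _ _ _   | tri≈ _ t≡v _ = ⊥-elim (t≢v t≡v)
... | tri> _ _ u<t | tri> _ _ v<t = sameSide-above u<t v<t

sameSide-sym : SameSide t u v → SameSide t v u
sameSide-sym (sameSide e₁ e₂) = sameSide (sym e₁) (sym e₂)

does-≡⇒ : ∀ {p q} {P : Set p} {Q : Set q} (P? : Dec P) (Q? : Dec Q) → does P? ≡ does Q? → P → Q
does-≡⇒ P? (yes Q-holds) _ _ = Q-holds
does-≡⇒ P? (no _)        e P-holds with () ← trans (sym (dec-true P? P-holds)) e

sameSide-<ˡ : SameSide t u v → t < u → t < v
sameSide-<ˡ {t = t} {u} {v} s = does-≡⇒ (t <? u) (t <? v) (SameSide.seen-from-below s)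

sameSide-<ʳ : SameSide t u v → u < t → v < t
sameSide-<ʳ {t = t} {u} {v} s = does-≡⇒ (u <? t) (v <? t) (SameSide.seen-from-above s)

-- Opaque so that unification recovers its arguments instead of unfolding the comparisons.
opaque
  inOrder : Fin m → Fin m → Fin m → Fin m → ℕ
  inOrder w₁ w₂ w₃ w₄ = indicator ((w₁ <? w₂) ×-dec ((w₂ <? w₃) ×-dec (w₃ <? w₄)))

opaque
  unfolding inOrder

  inOrder-0 : ¬ (w₁ < w₂ × w₂ < w₃ × w₃ < w₄) → inOrder w₁ w₂ w₃ w₄ ≡ 0
  inOrder-0 {w₁ = w₁} {w₂} {w₃} {w₄} ¬ordered =
    cong (if_then 1 else 0) (dec-false ((w₁ <? w₂) ×-dec ((w₂ <? w₃) ×-dec (w₃ <? w₄))) ¬ordered)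

  inOrder-1 : w₁ < w₂ → w₂ < w₃ → w₃ < w₄ → inOrder w₁ w₂ w₃ w₄ ≡ 1
  inOrder-1 {w₁ = w₁} {w₂} {w₃} {w₄} w₁<w₂ w₂<w₃ w₃<w₄ =
    cong (if_then 1 else 0)
      (dec-true ((w₁ <? w₂) ×-dec ((w₂ <? w₃) ×-dec (w₃ <? w₄))) (w₁<w₂ , w₂<w₃ , w₃<w₄))

  inOrder-replace₁ : SameSide w₂ u v → inOrder u w₂ w₃ w₄ ≡ inOrder v w₂ w₃ w₄
  inOrder-replace₁ {w₂ = w₂} {w₃ = w₃} {w₄ = w₄} s =
    cong (λ β → if β ∧ does ((w₂ <? w₃) ×-dec (w₃ <? w₄)) then 1 else 0) (SameSide.seen-from-above s)

  inOrder-replace₂ : SameSide w₁ u v → SameSide w₃ u v → inOrder w₁ u w₃ w₄ ≡ inOrder w₁ v w₃ w₄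
  inOrder-replace₂ {w₃ = w₃} {w₄ = w₄} s₁ s₃ =
    cong₂ (λ β γ → if β ∧ (γ ∧ does (w₃ <? w₄)) then 1 else 0)
      (SameSide.seen-from-below s₁) (SameSide.seen-from-above s₃)

  inOrder-replace₃ : SameSide w₂ u v → SameSide w₄ u v → inOrder w₁ w₂ u w₄ ≡ inOrder w₁ w₂ v w₄
  inOrder-replace₃ {w₂ = w₂} {w₁ = w₁} s₂ s₄ =
    cong₂ (λ β γ → if does (w₁ <? w₂) ∧ (β ∧ γ) then 1 else 0)
      (SameSide.seen-from-below s₂) (SameSide.seen-from-above s₄)

  inOrder-replace₄ : SameSide w₃ u v → inOrder w₁ w₂ w₃ u ≡ inOrder w₁ w₂ w₃ v
  inOrder-replace₄ {w₃ = w₃} {w₁ = w₁} {w₂ = w₂} s =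
    cong (λ β → if does (w₁ <? w₂) ∧ (does (w₂ <? w₃) ∧ β) then 1 else 0) (SameSide.seen-from-below s)

exchange : ∀ {A : Set} {a b c d : A} (F : A → A → ℕ) →
  (F a c ≡ F b c × F a d ≡ F b d) ⊎ (F a c ≡ F a d × F b c ≡ F b d) →
  F a c + F b d ≡ F a d + F b c
exchange {a = a} {b} {c} {d} F (inj₁ (ac≡bc , ad≡bd)) =
  trans (cong₂ _+_ ac≡bc (sym ad≡bd)) (+-comm (F b c) (F a d))
exchange F (inj₂ (ac≡ad , bc≡bd)) = cong₂ _+_ ac≡ad (sym bc≡bd)

ExchangeNeutral : (a b c d x q : Fin m) → Set
ExchangeNeutral a b c d x q = (SameSide x a b × SameSide q a b) ⊎ (SameSide x c d × SameSide q c d)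

-- count x y px py weighs the ordered pair of edges {x , px}, {y , py}.
record PairStatistic (m : ℕ) : Set where
  field
    count : Fin m → Fin m → Fin m → Fin m → ℕ
    count-unordered : ∀ {x y px py} → ¬ x < y → count x y px py ≡ 0
    count-closer₁ : ∀ {x y px py} → px < x → count x y px py ≡ 0
    count-closer₂ : ∀ {x y px py} → py < y → count x y px py ≡ 0
    count-exchange-second : ∀ {a b c d x q} → a < b → b < c → c < d → ExchangeNeutral a b c d x q →
      count x a q c + count x b q d ≡ count x a q d + count x b q c
    count-exchange-first : ∀ {a b c d x q} → a < b → b < c → c < d → ExchangeNeutral a b c d x q →
      count a x c q + count b x d q ≡ count a x d q + count b x c q

  total : (Fin m → Fin m) → ℕ
  total p = ∑[ x < m ] ∑[ y < m ] count x y (p x) (p y)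

nesting : PairStatistic m
nesting = record
  { count                 = λ x y px py → inOrder x y py px
  ; count-unordered       = λ ¬x<y → inOrder-0 λ (x<y , _) → ¬x<y x<y
  ; count-closer₁         = λ px<x → inOrder-0 λ (x<y , y<py , py<px) →
                              <-asym (<-trans x<y (<-trans y<py py<px)) px<x
  ; count-closer₂         = λ py<y → inOrder-0 λ (_ , y<py , _) → <-asym y<py py<y
  ; count-exchange-second = λ {a} {b} {c} {d} {x} {q} a<b b<c c<d →
      let a<c = <-trans a<b b<c; b<d = <-trans b<c c<d; a<d = <-trans a<c c<d in
      exchange (λ u v → inOrder x u v q) ∘
      Sum.map (λ (x̃ , _) → inOrder-replace₂ x̃ (sameSide-above a<c b<c) ,
                           inOrder-replace₂ x̃ (sameSide-above a<d b<d))
              (λ (_ , q̃) → inOrder-replace₃ (sameSide-below a<c a<d) q̃ ,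
                           inOrder-replace₃ (sameSide-below b<c b<d) q̃)
  ; count-exchange-first  = λ {x = x} {q = q} _ _ _ → exchange (λ u v → inOrder u x q v) ∘
      Sum.map (λ (x̃ , _) → inOrder-replace₁ x̃ , inOrder-replace₁ x̃)
              (λ (_ , q̃) → inOrder-replace₄ q̃ , inOrder-replace₄ q̃)
  }

crossing : PairStatistic m
crossing = record
  { count                 = λ x y px py → inOrder x y px py
  ; count-unordered       = λ ¬x<y → inOrder-0 λ (x<y , _) → ¬x<y x<y
  ; count-closer₁         = λ px<x → inOrder-0 λ (x<y , y<px , _) → <-asym (<-trans x<y y<px) px<x
  ; count-closer₂         = λ py<y → inOrder-0 λ (_ , y<px , px<py) → <-asym (<-trans y<px px<py) py<y
  ; count-exchange-second = λ {x = x} {q = q} _ _ _ → exchange (λ u v → inOrder x u q v) ∘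
      Sum.map (λ (x̃ , q̃) → inOrder-replace₂ x̃ q̃ , inOrder-replace₂ x̃ q̃)
              (λ (_ , q̃) → inOrder-replace₄ q̃ , inOrder-replace₄ q̃)
  ; count-exchange-first  = λ {x = x} {q = q} _ _ _ → exchange (λ u v → inOrder u x v q) ∘
      Sum.map (λ (x̃ , _) → inOrder-replace₁ x̃ , inOrder-replace₁ x̃)
              (λ (x̃ , q̃) → inOrder-replace₃ x̃ q̃ , inOrder-replace₃ x̃ q̃)
  }

opaque
  unfolding inOrder

  ne≡total-nesting : ∀ {n} (M : Matching n) → ne M ≡ PairStatistic.total nesting (partner M)
  ne≡total-nesting M = length-filter-allFin-pairs (isNesting? M)

  cr≡total-crossing : ∀ {n} (M : Matching n) → cr M ≡ PairStatistic.total crossing (partner M)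
  cr≡total-crossing M = length-filter-allFin-pairs (isCrossing? M)

sameOpenersClosers : ∀ {n} {M N : Matching n} →
  (∀ i → SameSide i (partner M i) (partner N i)) → SameOpenersClosers M N
sameOpenersClosers aligned =
  (λ i → sameSide-<ˡ (sameSide-sym (aligned i)) , sameSide-<ˡ (aligned i)) ,
  (λ i → sameSide-<ʳ (sameSide-sym (aligned i)) , sameSide-<ʳ (aligned i))

module Exchange {n : ℕ} (X Y : Matching n) {a b c d : Fin (2 * n)}
  (a<b : a < b) (b<c : b < c) (c<d : c < d)
  (Xa : partner X a ≡ c) (Xb : partner X b ≡ d) (Ya : partner Y a ≡ d) (Yb : partner Y b ≡ c)
  (agree : ∀ x → x ≢ a → x ≢ b → x ≢ c → x ≢ d → partner X x ≡ partner Y x)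
  (unlinked : ∀ x → a < x → x < b → ¬ (c < partner X x × partner X x < d))
  where

  private
    P = partner X
    Q = partner Y
    a<c = <-trans a<b b<c
    b<d = <-trans b<c c<d
    a<d = <-trans a<c c<d

    Xc : P c ≡ a
    Xc = subst (λ y → P y ≡ a) Xa (involutive X a)

    Xd : P d ≡ b
    Xd = subst (λ y → P y ≡ b) Xb (involutive X b)

    Yc : Q c ≡ b
    Yc = subst (λ y → Q y ≡ b) Yb (involutive Y b)

    Yd : Q d ≡ a
    Yd = subst (λ y → Q y ≡ a) Ya (involutive Y a)

  Outside : Fin (2 * n) → Set
  Outside x = x ≢ a × x ≢ b × x ≢ c × x ≢ d

  outside-partner : ∀ {x} → Outside x → Outside (P x)
  outside-partner {x} (x≢a , x≢b , x≢c , x≢d) =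
    x≢c ∘ inverse Xa , x≢d ∘ inverse Xb , x≢a ∘ inverse Xc , x≢b ∘ inverse Xd
    where
    inverse : ∀ {y z} → P y ≡ z → P x ≡ y → x ≡ z
    inverse Py≡z Px≡y = trans (sym (involutive X x)) (trans (cong P Px≡y) Py≡z)

  closer-or-outside : ∀ {x} → x ≢ a → x ≢ b → (P x < x × Q x < x) ⊎ Outside x
  closer-or-outside {x} x≢a x≢b with x ≟ c | x ≟ d
  ... | yes refl | _        = inj₁ (subst (_< c) (sym Xc) a<c , subst (_< c) (sym Yc) b<c)
  ... | no _     | yes refl = inj₁ (subst (_< d) (sym Xd) b<d , subst (_< d) (sym Yd) a<d)
  ... | no x≢c   | no x≢d   = inj₂ (x≢a , x≢b , x≢c , x≢d)

  agree-outside : ∀ {x} → Outside x → P x ≡ Q x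
  agree-outside {x} (x≢a , x≢b , x≢c , x≢d) = agree x x≢a x≢b x≢c x≢d

  neutral : ∀ {x} → Outside x → ExchangeNeutral a b c d x (P x)
  neutral {x} out@(x≢a , x≢b , x≢c , x≢d)
    with outside-partner out | (a <? x) ×-dec (x <? b) | (a <? P x) ×-dec (P x <? b)
  ... | _ , _ , Px≢c , Px≢d | yes (a<x , x<b) | _ =
    inj₂ (sameSide-below (<-trans x<b b<c) (<-trans x<b b<d) ,
          sameSide-outside c<d Px≢c Px≢d (unlinked x a<x x<b))
  ... | _ | no _ | yes (a<Px , Px<b) =
    inj₂ (sameSide-outside c<d x≢c x≢d
            (subst (λ y → ¬ (c < y × y < d)) (involutive X x) (unlinked (P x) a<Px Px<b)) ,
          sameSide-below (<-trans Px<b b<c) (<-trans Px<b b<d))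
  ... | Px≢a , Px≢b , _ | no x∉ab | no Px∉ab =
    inj₁ (sameSide-outside a<b x≢a x≢b x∉ab , sameSide-outside a<b Px≢a Px≢b Px∉ab)

  aligned : ∀ x → SameSide x (P x) (Q x)
  aligned x with x ≟ a | x ≟ b
  ... | yes refl | _        = sameSide-below (subst (a <_) (sym Xa) a<c) (subst (a <_) (sym Ya) a<d)
  ... | no _     | yes refl = sameSide-below (subst (b <_) (sym Xb) b<d) (subst (b <_) (sym Yb) b<c)
  ... | no x≢a   | no x≢b with closer-or-outside x≢a x≢b
  ...   | inj₁ (Px<x , Qx<x) = sameSide-above Px<x Qx<x
  ...   | inj₂ out           = subst (SameSide x (P x)) (agree-outside out) (sameSide refl refl)

  module _ (S : PairStatistic (2 * n)) where
    open PairStatistic S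

    corner-sum : ∀ (R : Fin (2 * n) → Fin (2 * n)) →
      (count a a (R a) (R a) + count b a (R b) (R a)) + (count a b (R a) (R b) + count b b (R b) (R b)) ≡
      count a b (R a) (R b)
    corner-sum R = begin
      (count a a (R a) (R a) + count b a (R b) (R a)) + (count a b (R a) (R b) + count b b (R b) (R b))
        ≡⟨ cong₂ _+_ (cong₂ _+_ (count-unordered (<-irrefl refl)) (count-unordered (<-asym a<b)))
                     (cong (count a b (R a) (R b) +_) (count-unordered (<-irrefl refl))) ⟩
      count a b (R a) (R b) + 0
        ≡⟨ +-identityʳ _ ⟩
      count a b (R a) (R b) ∎

    total-exchange : total P + count a b d c ≡ total Q + count a b c d
    total-exchange = ∑∑-cong-except₂ a<b inner second-edge first-edge corner
      where
      inner : ∀ x y → x ≢ a → x ≢ b → y ≢ a → y ≢ b →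
        count x y (P x) (P y) ≡ count x y (Q x) (Q y)
      inner x y x≢a x≢b y≢a y≢b with closer-or-outside x≢a x≢b | closer-or-outside y≢a y≢b
      ... | inj₁ (Px<x , Qx<x) | _ = trans (count-closer₁ Px<x) (sym (count-closer₁ Qx<x))
      ... | inj₂ _ | inj₁ (Py<y , Qy<y) = trans (count-closer₂ Py<y) (sym (count-closer₂ Qy<y))
      ... | inj₂ out-x | inj₂ out-y = cong₂ (count x y) (agree-outside out-x) (agree-outside out-y)

      second-edge : ∀ x → x ≢ a → x ≢ b →
        count x a (P x) (P a) + count x b (P x) (P b) ≡ count x a (Q x) (Q a) + count x b (Q x) (Q b)
      second-edge x x≢a x≢b with closer-or-outside x≢a x≢b
      ... | inj₁ (Px<x , Qx<x) =
        trans (cong₂ _+_ (count-closer₁ Px<x) (count-closer₁ Px<x))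
              (sym (cong₂ _+_ (count-closer₁ Qx<x) (count-closer₁ Qx<x)))
      ... | inj₂ out = begin
        count x a (P x) (P a) + count x b (P x) (P b)
          ≡⟨ cong₂ _+_ (cong (count x a (P x)) Xa) (cong (count x b (P x)) Xb) ⟩
        count x a (P x) c + count x b (P x) d
          ≡⟨ count-exchange-second a<b b<c c<d (neutral out) ⟩
        count x a (P x) d + count x b (P x) c
          ≡⟨ cong₂ _+_ (cong₂ (count x a) (agree-outside out) (sym Ya))
                       (cong₂ (count x b) (agree-outside out) (sym Yb)) ⟩
        count x a (Q x) (Q a) + count x b (Q x) (Q b) ∎

      first-edge : ∀ x → x ≢ a → x ≢ b →
        count a x (P a) (P x) + count b x (P b) (P x) ≡ count a x (Q a) (Q x) + count b x (Q b) (Q x)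
      first-edge x x≢a x≢b with closer-or-outside x≢a x≢b
      ... | inj₁ (Px<x , Qx<x) =
        trans (cong₂ _+_ (count-closer₂ Px<x) (count-closer₂ Px<x))
              (sym (cong₂ _+_ (count-closer₂ Qx<x) (count-closer₂ Qx<x)))
      ... | inj₂ out = begin
        count a x (P a) (P x) + count b x (P b) (P x)
          ≡⟨ cong₂ _+_ (cong (λ y → count a x y (P x)) Xa) (cong (λ y → count b x y (P x)) Xb) ⟩
        count a x c (P x) + count b x d (P x)
          ≡⟨ count-exchange-first a<b b<c c<d (neutral out) ⟩
        count a x d (P x) + count b x c (P x)
          ≡⟨ cong₂ _+_ (cong₂ (count a x) (sym Ya) (agree-outside out))
                       (cong₂ (count b x) (sym Yb) (agree-outside out)) ⟩
        count a x (Q a) (Q x) + count b x (Q b) (Q x) ∎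

      corner : (count a a (P a) (P a) + count b a (P b) (P a)) + (count a b (P a) (P b) + count b b (P b) (P b))
               + count a b d c ≡
               (count a a (Q a) (Q a) + count b a (Q b) (Q a)) + (count a b (Q a) (Q b) + count b b (Q b) (Q b))
               + count a b c d
      corner = begin
        _ + count a b d c             ≡⟨ cong (_+ count a b d c) (trans (corner-sum P) (cong₂ (count a b) Xa Xb)) ⟩
        count a b c d + count a b d c ≡⟨ +-comm (count a b c d) _ ⟩
        count a b d c + count a b c d ≡⟨ cong (_+ count a b c d) (trans (corner-sum Q) (cong₂ (count a b) Ya Yb)) ⟨
        _ + count a b c d             ∎

  private
    inOrder-abcd : inOrder a b c d ≡ 1
    inOrder-abcd = inOrder-1 a<b b<c c<d

    inOrder-abdc : inOrder a b d c ≡ 0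
    inOrder-abdc = inOrder-0 λ (_ , _ , d<c) → <-asym c<d d<c

  open PairStatistic using (total)

  ne-exchange : ne X + 1 ≡ ne Y
  ne-exchange = begin
    ne X + 1                          ≡⟨ cong₂ _+_ (ne≡total-nesting X) (sym inOrder-abcd) ⟩
    total nesting P + inOrder a b c d ≡⟨ total-exchange nesting ⟩
    total nesting Q + inOrder a b d c ≡⟨ cong (total nesting Q +_) inOrder-abdc ⟩
    total nesting Q + 0               ≡⟨ +-identityʳ _ ⟩
    total nesting Q                   ≡⟨ ne≡total-nesting Y ⟨
    ne Y                              ∎

  cr-exchange : cr X ≡ cr Y + 1
  cr-exchange = begin
    cr X                               ≡⟨ cr≡total-crossing X ⟩
    total crossing P                   ≡⟨ +-identityʳ _ ⟨
    total crossing P + 0               ≡⟨ cong (total crossing P +_) inOrder-abdc ⟨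
    total crossing P + inOrder a b d c ≡⟨ total-exchange crossing ⟩
    total crossing Q + inOrder a b c d ≡⟨ cong₂ _+_ (cr≡total-crossing Y) (sym inOrder-abcd) ⟨
    cr Y + 1                           ∎

module _ {n : ℕ} {M : Matching n} {a b : Fin (2 * n)} where

  minimal-nesting-unlinked : IsNesting M a b →
    (∀ a′ b′ → IsNesting M a′ b′ → nestWidth M a b ≤ nestWidth M a′ b′) →
    ∀ x → a < x → x < b → ¬ (partner M b < partner M x × partner M x < partner M a)
  minimal-nesting-unlinked (_ , b<Mb , _) minimal x a<x x<b (Mb<Mx , Mx<Ma) =
    <⇒≱ (⊓-mono-< (∸-monoʳ-< a<x (<⇒≤ x<b)) (∸-monoˡ-< Mx<Ma (<⇒≤ Mb<Mx)))
        (minimal x b (x<b , b<Mb , Mb<Mx))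

  minimal-crossing-unlinked : IsCrossing M a b →
    (∀ a′ b′ → IsCrossing M a′ b′ → crossWidth M a b ≤ crossWidth M a′ b′) →
    ∀ x → a < x → x < b → ¬ (partner M a < partner M x × partner M x < partner M b)
  minimal-crossing-unlinked (_ , b<Ma , _) minimal x a<x x<b (Ma<Mx , Mx<Mb) =
    <⇒≱ (⊓-mono-< (∸-monoʳ-< a<x (<⇒≤ x<b)) (∸-monoʳ-< Ma<Mx (<⇒≤ Mx<Mb)))
        (minimal x b (x<b , <-trans b<Ma Ma<Mx , Mx<Mb))

lemma3p1 : (n : ℕ) (M N : Matching n) →
    (NCStep M N → SameOpenersClosers M N × ne N + 1 ≡ ne M × cr N ≡ cr M + 1) ×
    (CNStep M N → SameOpenersClosers M N × ne N ≡ ne M + 1 × cr N + 1 ≡ cr M)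
lemma3p1 n M N = nc-step , cn-step
  where
  nc-step : NCStep M N → SameOpenersClosers M N × ne N + 1 ≡ ne M × cr N ≡ cr M + 1
  nc-step (a , b , nest@(a<b , b<c , c<d) , minimal , (Na , _ , Nb , _ , agree)) =
    sameOpenersClosers {M = M} {N} (sameSide-sym ∘ E.aligned) , E.ne-exchange , E.cr-exchange
    where
    unlinked : ∀ x → a < x → x < b → ¬ (partner M b < partner N x × partner N x < partner M a)
    unlinked x a<x x<b = subst (λ y → ¬ (partner M b < y × y < partner M a))
      (sym (agree x (≢-sym (<⇒≢ a<x)) (<⇒≢ x<b) (<⇒≢ x<c) (<⇒≢ (<-trans x<c c<d))))
      (minimal-nesting-unlinked {M = M} nest minimal x a<x x<b)
      where x<c = <-trans x<b b<c
    module E = Exchange N M a<b b<c c<d Na Nb refl refl agree unlinked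

  cn-step : CNStep M N → SameOpenersClosers M N × ne N ≡ ne M + 1 × cr N + 1 ≡ cr M
  cn-step (a , b , cross@(a<b , b<c , c<d) , minimal , (Na , _ , Nb , _ , agree)) =
    sameOpenersClosers {M = M} {N} E.aligned , sym E.ne-exchange , sym E.cr-exchange
    where
    module E = Exchange M N a<b b<c c<d refl refl Na Nb
      (λ x x≢a x≢b x≢c x≢d → sym (agree x x≢a x≢b x≢c x≢d))
      (minimal-crossing-unlinked {M = M} cross minimal)
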